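{- Let $B$ be a finite set of Boolean functions with $[B] \subseteq \mathsf{R}_1$, and let $\mathcal{F}\in\{\mathsf{all},\mathsf{trans},\mathsf{total},\mathsf{ER}\}$. Then the problem $\mathrm{SAT}_{\mathcal{F}}(\{\Diamond,\Box,\downarrow,@\},B)$ is trivial: every formula of $\mathrm{HL}(\{\Diamond,\Box,\downarrow,@\},B)$ is satisfiable over $\mathcal{F}$.
   Context: Let PROP, NOM, SVAR be pairwise disjoint countably infinite sets of atomic propositions, nominals and state variables, and ATOM = PROP $\cup$ NOM $\cup$ SVAR. Boolean connectives are identified with Boolean functions $f:\{0,1\}^n\to\{0,1\}$; the constants $0$ (false) and $1$ (true) are nullary functions. Hybrid formulae are given by $\varphi ::= a \mid c(\varphi,\dots,\varphi) \mid \Diamond\varphi \mid \Box\varphi \mid \downarrow x.\varphi \mid @_t\varphi$ with $a\in$ ATOM, $c$ a Boolean connective, $x\in$ SVAR, $t\in$ NOM $\cup$ SVAR. A Kripke structure is $K=(W,R,\eta)$ with $R\subseteq W\times W$ and $\eta:\mathrm{PROP}\cup\mathrm{NOM}\to\mathcal{P}(W)$ with $|\eta(i)|=1$ for every nominal $i$; an assignment is $g:\mathrm{SVAR}\to W$. Semantics: $K,g,w\models a$ iff $w\in\eta(a)$ (for $a\in$ PROP $\cup$ NOM) resp. $w=g(a)$ (for $a\in$ SVAR); $K,g,w\models c(\varphi_1,\dots,\varphi_n)$ iff $f_c$ applied to the truth values of the $\varphi_i$ at $w$ gives $1$; $\Diamond\varphi$ holds at $w$ iff $\varphi$ holds at some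 $R$-successor of $w$; $\Box\varphi$ iff $\varphi$ holds at all $R$-successors; $@_t\varphi$ holds iff $\varphi$ holds at the state denoted by $t$ (the element of $\eta(t)$ or $g(t)$); $K,g,w\models\downarrow x.\varphi$ iff $K,g',w\models\varphi$ where $g'$ agrees with $g$ except $g'(x)=w$. For $O\subseteq\{\Diamond,\Box,\downarrow,@\}$ and a finite set $B$ of Boolean functions, $\mathrm{HL}(O,B)$ is the set of hybrid formulae using only modal/hybrid operators from $O$ (where $\downarrow$ stands for all binders $\downarrow x.$ and $@$ for all $@_t$) and Boolean connectives from $B$. For a class $\mathcal{F}$ of frames $(W,R)$, $\mathrm{SAT}_{\mathcal{F}}(O,B)$ is the problem: given $\varphi\in\mathrm{HL}(O,B)$, is there a Kripke structure $K$ whose frame $(W,R)$ lies in $\mathcal{F}$, an assignment $g$ and $w\in W$ with $K,g,w\models\varphi$? Frame classes: $\mathsf{all}$ (all frames), $\mathsf{trans}$ ($R$ transitive), $\mathsf{total}$ (every state has an $R$-successor), $\mathsf{ER}$ ($R$ an equivalence relation). A clone is a set of Boolean functions containing all projections and closed under composition; $[B]$ is the smallest clone containing $B$. $\mathsf{R}_1$ is the clone of all $1$-reproducing functions, i.e. $f$ with $f(1,\dots,1)=1$. -}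

module Defs where

open import Data.Nat using (ℕ; _≟_)
open import Relation.Nullary using (yes; no)
open import Data.Fin using (Fin)
open import Data.Bool using (Bool; true)
open import Data.List using (List; length; lookup)
open import Data.Product using (Σ; _×_; _,_; proj₁; proj₂; ∃)
open import Data.Sum using (_⊎_)
open import Data.Unit using (⊤)
open import Relation.Binary.PropositionalEquality using (_≡_)

BoolFun : ℕ → Set
BoolFun n = (Fin n → Bool) → Bool

record Connective : Set where
  constructor mkConn
  field
    arity : ℕ
    fun   : BoolFun arity
open Connective public

ConnSet : Set
ConnSet = List Connective

data InClone (B : ConnSet) : (n : ℕ) → BoolFun n → Set where
  proj : ∀ {n} (i : Fin n) → InClone B n (λ x → x i)
  comp : ∀ {n} (k : Fin (length B)) (gs : Fin (arity (lookup B k)) → BoolFun n) →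
         (∀ j → InClone B n (gs j)) →
         InClone B n (λ x → fun (lookup B k) (λ j → gs j x))

R₁ : ∀ {n} → BoolFun n → Set
R₁ f = f (λ _ → true) ≡ true

CloneSubR₁ : ConnSet → Set
CloneSubR₁ B = ∀ n (f : BoolFun n) → InClone B n f → R₁ f

data Atom : Set where
  prop : ℕ → Atom
  nom  : ℕ → Atom
  svar : ℕ → Atom

data NomOrVar : Set where
  nomT  : ℕ → NomOrVar
  svarT : ℕ → NomOrVar

data HL (B : ConnSet) : Set where
  atom : Atom → HL B
  conn : (k : Fin (length B)) → (Fin (arity (lookup B k)) → HL B) → HL B
  ◇    : HL B → HL B
  □    : HL B → HL B
  bind : (x : ℕ) → HL B → HL B
  at   : NomOrVar → HL B → HL B

record Kripke : Set₁ where
  field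
    W   : Set
    R   : W → W → Set
    ηP  : ℕ → W → Set
    ηN  : ℕ → W                -- η on NOM: η(i) = {ηN i}, a singleton
open Kripke public

Assignment : Kripke → Set
Assignment K = ℕ → W K

update : {A : Set} → (ℕ → A) → ℕ → A → ℕ → A
update g x w y with y ≟ x
... | yes _ = w
... | no  _ = g y

denote : (K : Kripke) → Assignment K → NomOrVar → W K
denote K g (nomT i)  = ηN K i
denote K g (svarT x) = g x

sat : ∀ {B} (K : Kripke) → Assignment K → W K → HL B → Set
sat K g w (atom (prop p)) = ηP K p w
sat K g w (atom (nom i))  = w ≡ ηN K i
sat K g w (atom (svar x)) = w ≡ g x
sat {B} K g w (conn k φs) =
  -- f_c applied to the truth values of the φᵢ at w gives 1
  Σ (Fin (arity (lookup B k)) → Bool) λ b →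
    (∀ i → (b i ≡ true → sat K g w (φs i)) × (sat K g w (φs i) → b i ≡ true)) ×
    (fun (lookup B k) b ≡ true)
sat K g w (◇ φ)      = Σ (W K) λ v → R K w v × sat K g v φ
sat K g w (□ φ)      = ∀ v → R K w v → sat K g v φ
sat K g w (bind x φ) = sat K (update g x w) w φ
sat K g w (at t φ)   = sat K g (denote K g t) φ

data FrameClass : Set where
  all total trans ER : FrameClass

InClass : FrameClass → (W : Set) → (W → W → Set) → Set
InClass all   W R = ⊤
InClass trans W R = ∀ u v w → R u v → R v w → R u w
InClass total W R = ∀ u → Σ W λ v → R u v
InClass ER    W R = (∀ u → R u u) × (∀ u v → R u v → R v u) ×
                    (∀ u v w → R u v → R v w → R u w)

Satisfiable : ∀ {B} → FrameClass → HL B → Set₁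
Satisfiable 𝓕 φ = Σ Kripke λ K → InClass 𝓕 (W K) (R K) ×
                   Σ (Assignment K) λ g → Σ (W K) λ w → sat K g w φ

module Submission where

open import Defs
open import Data.Unit using (⊤; tt)
open import Data.Bool using (true)
open import Data.Fin using (Fin)
open import Data.List using (length; lookup)
open import Data.Product using (_,_)
open import Relation.Binary.PropositionalEquality using (refl)

-- Take the one-point reflexive frame and make every proposition true there.
-- Every atom then holds at the single state, the modal and hybrid operators
-- can only move back to that state, and a 1-reproducing connective maps
-- all-true arguments to true; so by induction every formula holds.
-- The one-point reflexive frame is transitive, total and an equivalence.

connective-R₁ : ∀ {B} → CloneSubR₁ B → (k : Fin (length B)) → R₁ (fun (lookup B k))
connective-R₁ [B]⊆R₁ k = [B]⊆R₁ _ _ (comp k (λ j x → x j) proj)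

pointKripke : Kripke
pointKripke = record { W = ⊤ ; R = λ _ _ → ⊤ ; ηP = λ _ _ → ⊤ ; ηN = λ _ → tt }

pointKripke-inClass : (𝓕 : FrameClass) → InClass 𝓕 (W pointKripke) (R pointKripke)
pointKripke-inClass all   = tt
pointKripke-inClass total = λ _ → tt , tt
pointKripke-inClass trans = λ _ _ _ _ _ → tt
pointKripke-inClass ER    = (λ _ → tt) , (λ _ _ _ → tt) , (λ _ _ _ _ _ → tt)

sat-pointKripke : ∀ {B} → (∀ k → R₁ (fun (lookup B k))) →
                  (g : Assignment pointKripke) (φ : HL B) → sat pointKripke g tt φ
sat-pointKripke B⊆R₁ g (atom (prop p)) = tt
sat-pointKripke B⊆R₁ g (atom (nom i))  = refl
sat-pointKripke B⊆R₁ g (atom (svar x)) = refl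
sat-pointKripke B⊆R₁ g (conn k φs)     =
  (λ _ → true) , (λ i → (λ _ → sat-pointKripke B⊆R₁ g (φs i)) , (λ _ → refl)) , B⊆R₁ k
sat-pointKripke B⊆R₁ g (◇ φ)      = tt , tt , sat-pointKripke B⊆R₁ g φ
sat-pointKripke B⊆R₁ g (□ φ)      = λ _ _ → sat-pointKripke B⊆R₁ g φ
sat-pointKripke B⊆R₁ g (bind x φ) = sat-pointKripke B⊆R₁ (update g x tt) φ
sat-pointKripke B⊆R₁ g (at t φ)   = sat-pointKripke B⊆R₁ g φ

theorem2 : (B : ConnSet) → CloneSubR₁ B → (𝓕 : FrameClass) →
           (φ : HL B) → Satisfiable 𝓕 φ
theorem2 B [B]⊆R₁ 𝓕 φ =
  pointKripke , pointKripke-inClass 𝓕 , (λ _ → tt) , tt ,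
  sat-pointKripke (connective-R₁ [B]⊆R₁) (λ _ → tt) φ
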